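{- Let $n\ge 1$ and let $c=(c_1,\ldots,c_n)$ be a dominating composition of $2n+1$ into $n$ parts; set $c_{n+1}:=1$. Let $1\le i\le n$. (i) If $c_i>1$ and $c_{i+1}>1$, then there exists $j>i$ (with $j\le n$) such that $f(c;i+1,j)=0$ and $c_{j+1}=1$. (ii) If $c_i=1$ and $c_{i+1}=1$, then there exists $j<i$ such that $f(c;j,i-1)>0$.
   Context: For a sequence $c=(c_1,\ldots,c_l)$ of positive integers and $1\le i\le j\le l$, $f(c;i,j)=\sum_{t=i}^{j}(c_t-2)$. A composition $c=(c_1,\ldots,c_l)$ (sequence of positive integers) is dominating if $f(c;1,i)>0$ for every $1\le i\le l$. -}

module Defs where

open import Data.Nat using (ℕ; zero; suc; _+_; _∸_; _≤_; _<_)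
open import Data.Nat.Properties using (_≤?_)
open import Data.Integer as ℤ using (ℤ; +_)
open import Data.List using (List; map; applyUpTo)
open import Data.List.Relation.Unary.All using (All)
open import Data.Vec as Vec using (Vec; toList)
open import Data.Fin using (fromℕ<)
open import Relation.Nullary using (yes; no)
open import Relation.Binary.PropositionalEquality using (_≡_)

-- 1-indexed entry c_t of a sequence c = (c_1,…,c_n).
-- Out of range (t = 0 or t > n) the value is 1; in particular c_{n+1} = 1,
-- which is the paper's convention "set c_{n+1} := 1".
entry : ∀ {n} → Vec ℕ n → ℕ → ℕ
entry {n} c zero = 1
entry {n} c (suc t) with suc t ≤? n
... | yes p = Vec.lookup c (fromℕ< p)
... | no _  = 1

range : ℕ → ℕ → List ℕ
range i j = applyUpTo (λ k → i + k) (suc j ∸ i)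

sumℤ : List ℤ → ℤ
sumℤ = Data.List.foldr ℤ._+_ (+ 0)

f : ∀ {n} → Vec ℕ n → ℕ → ℕ → ℤ
f c i j = sumℤ (map (λ t → + entry c t ℤ.- + 2) (range i j))

IsComposition : ∀ {n} → ℕ → Vec ℕ n → Set
IsComposition m c = All (λ x → 1 ≤ x) (toList c) × (Vec.sum c ≡ m)
  where open import Data.Product using (_×_)

Dominating : ∀ {n} → Vec ℕ n → Set
Dominating {n} c = ∀ i → 1 ≤ i → i ≤ n → + 0 ℤ.< f c 1 i

-- Part (i): the partial sums g j = f(c; i+1, j) start with g (i+1) = c_{i+1} − 2 ≥ 0, and they end
-- negative: f(c; 1, n) = (2n+1) − 2n = 1 and f(c; 1, i) ≥ 1 give g n ≤ 0, and c_{n+1} = 1 gives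
-- g (n+1) = g n − 1. As every step c_t − 2 is at least −1, at the last j ≤ n with g j ≥ 0 before
-- the sum turns negative we must have g j = 0 and c_{j+1} = 1.
-- Part (ii): c_1 = 1 would make f(c; 1, 1) = −1, so i ≥ 2 and j = 1 works by dominance.

module Submission where

open import Defs
open import Data.Nat using (ℕ; suc; _+_; _*_; _∸_; _≤_; _<_)
open import Data.Integer as ℤ using (+_)
open import Data.Vec using (Vec)
open import Data.Product using (_×_; ∃)
open import Relation.Binary.PropositionalEquality using (_≡_)

open import Data.Nat using (zero; z≤n; s≤s; s≤s⁻¹; _≤′_; ≤′-refl; ≤′-step)
open import Data.Nat.Properties
  using (_≤?_; ≤-refl; <-irrefl; m≤n⇒m≤1+n; ≤∧≢⇒<; ≤⇒≤′; ≤′⇒≤;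
         n∸n≡0; +-∸-assoc; m+[n∸m]≡n; *-suc; ≤-trans; n≤1+n)
  renaming (+-comm to ℕ+-comm)
open import Data.Integer using (ℤ; -[1+_]; +≤+; +<+; -≤+; -<+)
import Data.Integer.Properties as ℤP
open import Data.Integer.Solver using (module +-*-Solver)
open import Algebra.Properties.AbelianGroup ℤP.+-0-abelianGroup using (∙-cancelʳ)
open import Data.List using ([]; _∷_; _++_; _∷ʳ_; map; applyUpTo; [_])
open import Data.List.Properties using (map-applyUpTo; applyUpTo-∷ʳ; map-++)
open import Data.List.Relation.Unary.All using (All)
open import Data.Vec as Vec using ([]; _∷_; toList)
open import Data.Vec.Relation.Unary.All.Properties using (lookup⁺; toList⁻)
open import Data.Fin using (fromℕ<)
open import Data.Product using (_,_)
open import Relation.Nullary using (yes; no; contradiction)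
open import Relation.Binary.PropositionalEquality
  using (refl; sym; trans; cong; cong₂; subst; module ≡-Reasoning)
open ≡-Reasoning

sumRange : (ℕ → ℤ) → ℕ → ℕ → ℤ
sumRange h i j = sumℤ (map h (range i j))

sumℤ-++ : ∀ xs ys → sumℤ (xs ++ ys) ≡ sumℤ xs ℤ.+ sumℤ ys
sumℤ-++ []       ys = sym (ℤP.+-identityˡ _)
sumℤ-++ (x ∷ xs) ys = trans (cong (λ y → x ℤ.+ y) (sumℤ-++ xs ys)) (sym (ℤP.+-assoc x _ _))

range-empty : ∀ i → range (suc i) i ≡ []
range-empty i = cong (applyUpTo (λ k → suc i + k)) (n∸n≡0 i)

range-snoc : ∀ {i j} → i ≤ suc j → range i (suc j) ≡ range i j ∷ʳ suc j
range-snoc {i} {j} i≤1+j = begin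
  applyUpTo (λ k → i + k) (suc (suc j) ∸ i)   ≡⟨ cong (applyUpTo (λ k → i + k)) (+-∸-assoc 1 i≤1+j) ⟩
  applyUpTo (λ k → i + k) (suc (suc j ∸ i))   ≡⟨ applyUpTo-∷ʳ (λ k → i + k) (suc j ∸ i) ⟨
  range i j ∷ʳ (i + (suc j ∸ i))              ≡⟨ cong (range i j ∷ʳ_) (m+[n∸m]≡n i≤1+j) ⟩
  range i j ∷ʳ suc j                          ∎

sumRange-empty : ∀ h i → sumRange h (suc i) i ≡ + 0
sumRange-empty h i = cong (λ xs → sumℤ (map h xs)) (range-empty i)

sumRange-snoc : ∀ h {i j} → i ≤ suc j → sumRange h i (suc j) ≡ sumRange h i j ℤ.+ h (suc j)
sumRange-snoc h {i} {j} i≤1+j = begin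
  sumℤ (map h (range i (suc j)))              ≡⟨ cong (λ xs → sumℤ (map h xs)) (range-snoc i≤1+j) ⟩
  sumℤ (map h (range i j ++ [ suc j ]))       ≡⟨ cong sumℤ (map-++ h (range i j) [ suc j ]) ⟩
  sumℤ (map h (range i j) ++ [ h (suc j) ])   ≡⟨ sumℤ-++ (map h (range i j)) [ h (suc j) ] ⟩
  sumRange h i j ℤ.+ (h (suc j) ℤ.+ + 0)      ≡⟨ cong (λ y → sumRange h i j ℤ.+ y) (ℤP.+-identityʳ (h (suc j))) ⟩
  sumRange h i j ℤ.+ h (suc j)                ∎

sumRange-split : ∀ h {i k j} → i ≤ suc k → k ≤ j →
                 sumRange h i j ≡ sumRange h i k ℤ.+ sumRange h (suc k) j
sumRange-split h {i} {k} i≤1+k k≤j = go (≤⇒≤′ k≤j)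
  where
  go : ∀ {j} → k ≤′ j → sumRange h i j ≡ sumRange h i k ℤ.+ sumRange h (suc k) j
  go ≤′-refl = begin
    sumRange h i k                                ≡⟨ ℤP.+-identityʳ _ ⟨
    sumRange h i k ℤ.+ + 0                        ≡⟨ cong (λ y → sumRange h i k ℤ.+ y) (sumRange-empty h k) ⟨
    sumRange h i k ℤ.+ sumRange h (suc k) k       ∎
  go (≤′-step {j} k≤′j) = begin
    sumRange h i (suc j)                               ≡⟨ sumRange-snoc h (≤-trans i≤1+k (s≤s (≤′⇒≤ k≤′j))) ⟩
    sumRange h i j ℤ.+ h (suc j)                       ≡⟨ cong (λ y → y ℤ.+ h (suc j)) (go k≤′j) ⟩
    (sumRange h i k ℤ.+ sumRange h (suc k) j) ℤ.+ h (suc j)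
                                                       ≡⟨ ℤP.+-assoc (sumRange h i k) _ _ ⟩
    sumRange h i k ℤ.+ (sumRange h (suc k) j ℤ.+ h (suc j))
                                                       ≡⟨ cong (λ y → sumRange h i k ℤ.+ y) (sumRange-snoc h (s≤s (≤′⇒≤ k≤′j))) ⟨
    sumRange h i k ℤ.+ sumRange h (suc k) (suc j)      ∎

excess : ∀ {n} → Vec ℕ n → ℕ → ℤ
excess c t = + entry c t ℤ.- + 2

entry-head : ∀ {n} x (xs : Vec ℕ n) → entry (x ∷ xs) 1 ≡ x
entry-head {n} x xs with 1 ≤? suc n
... | yes _   = refl
... | no 1≰n  = contradiction (s≤s z≤n) 1≰n

entry-tail : ∀ {n} x (xs : Vec ℕ n) t → entry (x ∷ xs) (suc (suc t)) ≡ entry xs (suc t)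
entry-tail {n} x xs t with suc (suc t) ≤? suc n | suc t ≤? n
... | yes _     | yes _     = refl
... | yes t+2≤  | no t+1≰   = contradiction (s≤s⁻¹ t+2≤) t+1≰
... | no t+2≰   | yes t+1≤  = contradiction (s≤s t+1≤) t+2≰
... | no _      | no _      = refl

entry-beyond : ∀ {n} (c : Vec ℕ n) → entry c (suc n) ≡ 1
entry-beyond {n} c with suc n ≤? n
... | yes n<n = contradiction n<n (<-irrefl refl)
... | no _    = refl

entry-positive : ∀ {n} {c : Vec ℕ n} → All (λ x → 1 ≤ x) (toList c) → ∀ t → 1 ≤ entry c t
entry-positive pos zero = s≤s z≤n
entry-positive {n} pos (suc t) with suc t ≤? n
... | yes t<n = lookup⁺ (toList⁻ pos) (fromℕ< t<n)
... | no _    = s≤s z≤n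

applyUpTo-cong : ∀ {A : Set} {g h : ℕ → A} → (∀ k → g k ≡ h k) → ∀ m → applyUpTo g m ≡ applyUpTo h m
applyUpTo-cong g≗h zero    = refl
applyUpTo-cong g≗h (suc m) = cong₂ _∷_ (g≗h 0) (applyUpTo-cong (λ k → g≗h (suc k)) m)

f-∷ : ∀ {n} x (xs : Vec ℕ n) i j → f (x ∷ xs) (suc (suc i)) (suc j) ≡ f xs (suc i) j
f-∷ x xs i j = cong sumℤ (begin
  map (excess (x ∷ xs)) (range (suc (suc i)) (suc j))            ≡⟨ map-applyUpTo _ _ (j ∸ i) ⟩
  applyUpTo (λ k → excess (x ∷ xs) (suc (suc (i + k)))) (j ∸ i)   ≡⟨ applyUpTo-cong shift (j ∸ i) ⟩
  applyUpTo (λ k → excess xs (suc (i + k))) (j ∸ i)               ≡⟨ map-applyUpTo _ _ (j ∸ i) ⟨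
  map (excess xs) (range (suc i) j)                               ∎)
  where
  shift : ∀ k → excess (x ∷ xs) (suc (suc (i + k))) ≡ excess xs (suc (i + k))
  shift k = cong (λ e → + e ℤ.- + 2) (entry-tail x xs (i + k))

open +-*-Solver

f[1,n]+2n≡sum : ∀ {n} (c : Vec ℕ n) → f c 1 n ℤ.+ + (2 * n) ≡ + Vec.sum c
f[1,n]+2n≡sum []                 = refl
f[1,n]+2n≡sum {suc n} (x ∷ xs) = begin
  f (x ∷ xs) 1 (suc n) ℤ.+ + (2 * suc n)                          ≡⟨⟩
  (excess (x ∷ xs) 1 ℤ.+ f (x ∷ xs) 2 (suc n)) ℤ.+ + (2 * suc n)
    ≡⟨ cong₂ (λ e s → ((+ e ℤ.- + 2) ℤ.+ s) ℤ.+ + (2 * suc n)) (entry-head x xs) (f-∷ x xs 0 n) ⟩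
  ((+ x ℤ.- + 2) ℤ.+ F) ℤ.+ + (2 * suc n)
    ≡⟨ cong (λ m → ((+ x ℤ.- + 2) ℤ.+ F) ℤ.+ m) (trans (cong +_ (*-suc 2 n)) (ℤP.pos-+ 2 (2 * n))) ⟩
  ((+ x ℤ.- + 2) ℤ.+ F) ℤ.+ (+ 2 ℤ.+ + (2 * n))
    ≡⟨ solve 3 (λ a s b → ((a :- con (+ 2)) :+ s) :+ (con (+ 2) :+ b) := a :+ (s :+ b)) refl (+ x) F (+ (2 * n)) ⟩
  + x ℤ.+ (F ℤ.+ + (2 * n))                                        ≡⟨ cong (λ y → + x ℤ.+ y) (f[1,n]+2n≡sum xs) ⟩
  + x ℤ.+ + Vec.sum xs                                             ≡⟨ ℤP.pos-+ x (Vec.sum xs) ⟨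
  + (x + Vec.sum xs)                                               ∎
  where F = f xs 1 n

f[1,n]≡1 : ∀ {n} {c : Vec ℕ n} → IsComposition (2 * n + 1) c → f c 1 n ≡ + 1
f[1,n]≡1 {n} {c} (_ , sum≡) = ∙-cancelʳ (+ (2 * n)) (f c 1 n) (+ 1) (begin
  f c 1 n ℤ.+ + (2 * n)   ≡⟨ f[1,n]+2n≡sum c ⟩
  + Vec.sum c             ≡⟨ cong +_ sum≡ ⟩
  + (2 * n + 1)           ≡⟨ cong +_ (ℕ+-comm (2 * n) 1) ⟩
  + (1 + 2 * n)           ≡⟨ ℤP.pos-+ 1 (2 * n) ⟩
  + 1 ℤ.+ + (2 * n)       ∎)

excess-nonneg : ∀ {e} → 1 < e → + 0 ℤ.≤ + e ℤ.- + 2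
excess-nonneg {suc (suc e)} _         = +≤+ z≤n
excess-nonneg {1}           (s≤s ())

x≤0⇒x-1<0 : ∀ {x} → x ℤ.≤ + 0 → x ℤ.+ -[1+ 0 ] ℤ.< + 0
x≤0⇒x-1<0 {+ zero}  _         = -<+
x≤0⇒x-1<0 {+ suc _} (+≤+ ())
x≤0⇒x-1<0 { -[1+ _ ]} _        = -<+

pos+x≡1⇒x≤0 : ∀ {a x} → + 0 ℤ.< a → a ℤ.+ x ≡ + 1 → x ℤ.≤ + 0
pos+x≡1⇒x≤0 {+ 1}           {+ zero}   _ _  = +≤+ z≤n
pos+x≡1⇒x≤0 {+ 1}           {+ suc _}  _ ()
pos+x≡1⇒x≤0 {+ suc (suc _)} {+ _}      _ ()
pos+x≡1⇒x≤0 {+ suc _}       { -[1+ _ ]} _ _  = -≤+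
pos+x≡1⇒x≤0 {+ zero}        (+<+ ())

0≤x∧x+e-2<0⇒x≡0∧e≡1 : ∀ {x e} → + 0 ℤ.≤ x → 1 ≤ e → x ℤ.+ (+ e ℤ.- + 2) ℤ.< + 0 → x ≡ + 0 × e ≡ 1
0≤x∧x+e-2<0⇒x≡0∧e≡1 {+ zero}  {1}           _ _ _        = refl , refl
0≤x∧x+e-2<0⇒x≡0∧e≡1 {+ suc _} {1}           _ _ (+<+ ())
0≤x∧x+e-2<0⇒x≡0∧e≡1 {+ _}     {suc (suc _)} _ _ (+<+ ())

sign-change : ∀ (g : ℕ → ℤ) {a b} → a ≤ b → + 0 ℤ.≤ g a → g (suc b) ℤ.< + 0 →
              ∃ λ j → a ≤ j × j ≤ b × + 0 ℤ.≤ g j × g (suc j) ℤ.< + 0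
sign-change g {a} a≤b 0≤g[a] = go (≤⇒≤′ a≤b)
  where
  go : ∀ {b} → a ≤′ b → g (suc b) ℤ.< + 0 → ∃ λ j → a ≤ j × j ≤ b × + 0 ℤ.≤ g j × g (suc j) ℤ.< + 0
  go ≤′-refl g[a+1]<0 = a , ≤-refl , ≤-refl , 0≤g[a] , g[a+1]<0
  go (≤′-step {b} a≤′b) g[b+2]<0 with + 0 ℤP.≤? g (suc b)
  ... | yes 0≤g[b+1] = suc b , ≤′⇒≤ (≤′-step a≤′b) , ≤-refl , 0≤g[b+1] , g[b+2]<0
  ... | no 0≰g[b+1]  with j , a≤j , j≤b , rest ← go a≤′b (ℤP.≰⇒> 0≰g[b+1])
    = j , a≤j , m≤n⇒m≤1+n j≤b , rest

return-to-zero : ∀ {n} (c : Vec ℕ n) → (∀ t → 1 ≤ entry c t) → ∀ {i} → i ≤ n →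
                 1 < entry c (suc i) → f c (suc i) n ℤ.≤ + 0 →
                 ∃ λ j → i < j × j ≤ n × f c (suc i) j ≡ + 0 × entry c (suc j) ≡ 1
return-to-zero {n} c positive {i} i≤n 1<c[i+1] tail≤0 = conclude (sign-change (f c (suc i)) i<n start end)
  where
  conclude : (∃ λ j → suc i ≤ j × j ≤ n × + 0 ℤ.≤ f c (suc i) j × f c (suc i) (suc j) ℤ.< + 0) →
             ∃ λ j → i < j × j ≤ n × f c (suc i) j ≡ + 0 × entry c (suc j) ≡ 1
  conclude (j , i<j , j≤n , 0≤f[i+1,j] , f[i+1,j+1]<0)
    with f≡0 , c≡1 ← 0≤x∧x+e-2<0⇒x≡0∧e≡1 0≤f[i+1,j] (positive (suc j))
                       (subst (λ y → y ℤ.< + 0) (sumRange-snoc (excess c) (m≤n⇒m≤1+n i<j)) f[i+1,j+1]<0)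
    = j , i<j , j≤n , f≡0 , c≡1

  i<n : i < n
  i<n = ≤∧≢⇒< i≤n λ i≡n →
    <-irrefl refl (subst (1 <_) (entry-beyond c) (subst (λ k → 1 < entry c (suc k)) i≡n 1<c[i+1]))

  start : + 0 ℤ.≤ f c (suc i) (suc i)
  start = subst (λ y → + 0 ℤ.≤ y) (sym single) (excess-nonneg 1<c[i+1])
    where
    single : f c (suc i) (suc i) ≡ excess c (suc i)
    single = begin
      f c (suc i) (suc i)                ≡⟨ sumRange-snoc (excess c) {j = i} ≤-refl ⟩
      f c (suc i) i ℤ.+ excess c (suc i) ≡⟨ cong (λ y → y ℤ.+ excess c (suc i)) (sumRange-empty (excess c) i) ⟩
      + 0 ℤ.+ excess c (suc i)           ≡⟨ ℤP.+-identityˡ _ ⟩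
      excess c (suc i)                   ∎

  end : f c (suc i) (suc n) ℤ.< + 0
  end = subst (λ y → y ℤ.< + 0) (sym (begin
      f c (suc i) (suc n)                  ≡⟨ sumRange-snoc (excess c) (s≤s i≤n) ⟩
      f c (suc i) n ℤ.+ excess c (suc n)   ≡⟨ cong (λ e → f c (suc i) n ℤ.+ (+ e ℤ.- + 2)) (entry-beyond c) ⟩
      f c (suc i) n ℤ.+ -[1+ 0 ]           ∎))
    (x≤0⇒x-1<0 tail≤0)

positive-prefix-before-1 : ∀ {n} (c : Vec ℕ n) → Dominating c → ∀ {i} → 1 ≤ i → i ≤ n → entry c i ≡ 1 →
                           ∃ λ j → 1 ≤ j × j < i × + 0 ℤ.< f c j (i ∸ 1)
positive-prefix-before-1 c dominating {1} _ 1≤n c₁≡1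
  with () ← subst (λ e → + 0 ℤ.< (+ e ℤ.- + 2) ℤ.+ + 0) c₁≡1 (dominating 1 ≤-refl 1≤n)
positive-prefix-before-1 c dominating {suc (suc i)} _ i+2≤n _ =
  1 , ≤-refl , s≤s (s≤s z≤n) , dominating (suc i) (s≤s z≤n) (≤-trans (n≤1+n _) i+2≤n)

lemma4p2 : (n : ℕ) → 1 ≤ n → (c : Vec ℕ n) → IsComposition (2 * n + 1) c → Dominating c →
    (i : ℕ) → 1 ≤ i → i ≤ n →
    ((1 < entry c i → 1 < entry c (suc i) →
        ∃ λ j → i < j × j ≤ n × f c (suc i) j ≡ + 0 × entry c (suc j) ≡ 1)
    × (entry c i ≡ 1 → entry c (suc i) ≡ 1 →
        ∃ λ j → 1 ≤ j × j < i × + 0 ℤ.< f c j (i ∸ 1)))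
lemma4p2 n _ c composition@(positive , _) dominating i 1≤i i≤n =
    (λ _ 1<c[i+1] → return-to-zero c (entry-positive positive) i≤n 1<c[i+1] tail≤0)
  , (λ c[i]≡1 _ → positive-prefix-before-1 c dominating 1≤i i≤n c[i]≡1)
  where
  tail≤0 : f c (suc i) n ℤ.≤ + 0
  tail≤0 = pos+x≡1⇒x≤0 (dominating i 1≤i i≤n)
             (trans (sym (sumRange-split (excess c) (s≤s z≤n) i≤n)) (f[1,n]≡1 composition))
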